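{- The sets $\mathcal{S}'$, $\mathcal{S}'_{\mathcal L}$, and $\mathcal{L}$ are infinite.
   Context: For an integer base $g\ge2$ and integer $m\ge0$, $s_g(m)$ denotes the sum of base-$g$ digits of $m$; $s_1(m):=0$. A positive integer $m$ has an $s$-decomposition if $m=\prod_{\nu=1}^n g_\nu^{e_\nu}$ with exponents $e_\nu\ge1$ and proper factors $1<g_\nu<m$, strictly increasing $g_1<\dots<g_n$ (not necessarily coprime), with $s_{g_\nu}(m)\ge g_\nu$ for each $\nu$; $\mathcal{S}'$ is the set of positive integers having an $s$-decomposition. $\mathcal{S}'_{\mathcal L}$ is the set of positive integers $m$ having a divisor $g$ with $s_g(m)\ge g$, and $\mathcal{L}$ the set of positive integers $m$ having a divisor $g$ with $s_g(m)=g$. -}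

module Defs where

open import Data.Nat using (ℕ; zero; suc; _+_; _*_; _^_; _≤_; _<_; _≥_; NonZero)
open import Data.Nat.DivMod using (_/_; _%_)
open import Data.Nat.Divisibility using (_∣_)
open import Data.List using (List; []; _∷_; map; foldr)
open import Data.List.Relation.Unary.All using (All)
open import Data.List.Relation.Unary.Linked using (Linked)
open import Data.Product using (_×_; _,_; ∃; ∃-syntax; proj₁; proj₂)
open import Relation.Binary.PropositionalEquality using (_≡_)

-- digit sum with fuel (fuel = m suffices since m / g < m for m > 0, g ≥ 2)
digitSumAux : ℕ → (g : ℕ) → .{{NonZero g}} → ℕ → ℕ
digitSumAux zero    g m       = zero
digitSumAux (suc f) g zero    = zero
digitSumAux (suc f) g (suc m) = (suc m % g) + digitSumAux f g (suc m / g)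

-- s g m : sum of base-g digits of m for g ≥ 2; s 1 m = 0 (and s 0 m = 0, unused)
s : ℕ → ℕ → ℕ
s zero          m = zero
s (suc zero)    m = zero
s (suc (suc k)) m = digitSumAux m (suc (suc k)) m

Factor : Set
Factor = ℕ × ℕ

prodFactors : List Factor → ℕ
prodFactors = foldr (λ p acc → proj₁ p ^ proj₂ p * acc) 1

GoodFactor : ℕ → Factor → Set
GoodFactor m (g , e) = 1 < g × g < m × 1 ≤ e × s g m ≥ g

HasSDecomposition : ℕ → Set
HasSDecomposition m =
  ∃[ f ] ∃[ fs ] (All (GoodFactor m) (f ∷ fs)
                 × Linked _<_ (map proj₁ (f ∷ fs))
                 × prodFactors (f ∷ fs) ≡ m)

InS' : ℕ → Set
InS' m = 1 ≤ m × HasSDecomposition m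

InS'L : ℕ → Set
InS'L m = 1 ≤ m × ∃[ g ] (g ∣ m × s g m ≥ g)

InL : ℕ → Set
InL m = 1 ≤ m × ∃[ g ] (g ∣ m × s g m ≡ g)

Infinite : (ℕ → Set) → Set
Infinite P = ∀ N → ∃[ m ] (N ≤ m × P m)

private
  t1 : s 10 1234 ≡ 10
  t1 = Relation.Binary.PropositionalEquality.refl
  t2 : s 2 7 ≡ 3
  t2 = Relation.Binary.PropositionalEquality.refl

{-# OPTIONS --safe #-}
module Submission where

-- In base g ≥ 2 the number g(2g − 1) has digits 1, g − 1, 0, so its digit sum is g and it
-- lies in L (hence in S'_L). For S' take g = 2t + 1 and h = 2t² + 2t + 1 with t ≥ 1 and
-- m = g²h: in base g, h = (t + 1) + t g gives m the digits t, t + 1, 0, 0 with sum g, and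
-- since g² = 2h − 1 we have m = h(2h − 1), whose base-h digit sum is h by the first case.

open import Defs
open import Data.Product using (_×_; _,_; map₂)
open import Data.Nat
open import Data.Nat.Properties
open import Data.Nat.DivMod
open import Data.Nat.Divisibility using (n∣m*n; divides-refl)
open import Data.Nat.Tactic.RingSolver using (solve-∀)
open import Data.List using ([]; _∷_)
open import Data.List.Relation.Unary.All using ([]; _∷_)
open import Data.List.Relation.Unary.Linked using ([-]; _∷_)
open import Relation.Binary.PropositionalEquality
open ≡-Reasoning

digitSumAux-zero : ∀ f g .{{_ : NonZero g}} → digitSumAux f g 0 ≡ 0
digitSumAux-zero zero    g = refl
digitSumAux-zero (suc f) g = refl

digitSumAux-fuel : ∀ {g} .{{_ : NonZero g}} → 1 < g → ∀ {f f′ m} → m ≤ f → m ≤ f′ →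
                   digitSumAux f g m ≡ digitSumAux f′ g m
digitSumAux-fuel {g} _ {f} {f′} {zero} _ _ =
  trans (digitSumAux-zero f g) (sym (digitSumAux-zero f′ g))
digitSumAux-fuel {g} 1<g {suc f} {suc f′} {suc m} (s≤s m≤f) (s≤s m≤f′) =
  cong (suc m % g +_) (digitSumAux-fuel 1<g (≤-trans m/g≤m m≤f) (≤-trans m/g≤m m≤f′))
  where
  m/g≤m : suc m / g ≤ m
  m/g≤m = <⇒≤pred (m/n<m (suc m) g 1<g)

s-step : ∀ {g} .{{_ : NonZero g}} → 1 < g → ∀ m → s g m ≡ m % g + s g (m / g)
s-step {suc zero} (s≤s ()) _
s-step {suc (suc k)} _ zero = refl
s-step {g@(suc (suc k))} 1<g (suc m) =
  cong (suc m % g +_) (digitSumAux-fuel 1<g (<⇒≤pred (m/n<m (suc m) g 1<g)) ≤-refl)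

s-zero : ∀ g → s g 0 ≡ 0
s-zero zero          = refl
s-zero (suc zero)    = refl
s-zero (suc (suc k)) = refl

s-digit : ∀ {g} .{{_ : NonZero g}} → 1 < g → ∀ {r} q → r < g → s g (r + q * g) ≡ r + s g q
s-digit {g} 1<g {r} q r<g = begin
  s g (r + q * g)                         ≡⟨ s-step 1<g (r + q * g) ⟩
  (r + q * g) % g + s g ((r + q * g) / g) ≡⟨ cong₂ (λ a b → a + s g b) lowDigit rest ⟩
  r + s g q                               ∎
  where
  lowDigit : (r + q * g) % g ≡ r
  lowDigit = trans ([m+kn]%n≡m%n r q g) (m<n⇒m%n≡m r<g)
  rest : (r + q * g) / g ≡ q
  rest = begin
    (r + q * g) / g   ≡⟨ +-distrib-/-∣ʳ r (divides-refl q) ⟩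
    r / g + q * g / g ≡⟨ cong₂ _+_ (m<n⇒m/n≡0 r<g) (m*n/n≡m q g) ⟩
    q                 ∎

s-single-digit : ∀ {g} .{{_ : NonZero g}} → 1 < g → ∀ {r} → r < g → s g r ≡ r
s-single-digit {g} 1<g {r} r<g = begin
  s g r           ≡⟨ cong (s g) (sym (+-identityʳ r)) ⟩
  s g (r + 0 * g) ≡⟨ s-digit 1<g 0 r<g ⟩
  r + s g 0       ≡⟨ cong (r +_) (s-zero g) ⟩
  r + 0           ≡⟨ +-identityʳ r ⟩
  r               ∎

s-*-base : ∀ {g} .{{_ : NonZero g}} → 1 < g → ∀ q → s g (q * g) ≡ s g q
s-*-base 1<g q = s-digit 1<g q (<-trans z<s 1<g)

s-two-digits : ∀ {g} .{{_ : NonZero g}} → 1 < g → ∀ {r q} → r < g → q < g → s g (r + q * g) ≡ r + q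
s-two-digits 1<g {r} {q} r<g q<g =
  trans (s-digit 1<g q r<g) (cong (r +_) (s-single-digit 1<g q<g))

lWitness : ℕ → ℕ
lWitness g = (pred g + g) * g

s-lWitness : ∀ {g} .{{_ : NonZero g}} → 1 < g → s g (lWitness g) ≡ g
s-lWitness {g@(suc n)} 1<g = begin
  s g ((n + g) * g)  ≡⟨ s-*-base 1<g (n + g) ⟩
  s g (n + g)        ≡⟨ cong (λ x → s g (n + x)) (sym (*-identityˡ g)) ⟩
  s g (n + 1 * g)    ≡⟨ s-two-digits 1<g ≤-refl 1<g ⟩
  n + 1              ≡⟨ +-comm n 1 ⟩
  g                  ∎

g≤lWitness : ∀ g → g ≤ lWitness g
g≤lWitness zero    = z≤n
g≤lWitness (suc n) = ≤-trans (m≤n+m (suc n) n) (m≤m*n (n + suc n) (suc n))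

lWitness∈L : ∀ {g} → 1 < g → InL (lWitness g)
lWitness∈L {g@(suc _)} 1<g =
  ≤-trans (<⇒≤ 1<g) (g≤lWitness g) , g , n∣m*n (pred g + g) , s-lWitness 1<g

gS : ℕ → ℕ
gS t = suc (t + t)

hS : ℕ → ℕ
hS t = suc t + t * gS t

mS : ℕ → ℕ
mS t = prodFactors ((gS t , 2) ∷ (hS t , 1) ∷ [])

mS≡hS*gS*gS : ∀ t → mS t ≡ hS t * gS t * gS t
mS≡hS*gS*gS t = reorder (gS t) (hS t)
  where
  reorder : ∀ g h → g * (g * 1) * (h * 1 * 1) ≡ h * g * g
  reorder = solve-∀

gS²≡pred-hS+hS : ∀ t → gS t * gS t ≡ t + t * gS t + hS t
gS²≡pred-hS+hS = expand
  where
  expand : ∀ t → suc (t + t) * suc (t + t) ≡ t + t * suc (t + t) + (suc t + t * suc (t + t))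
  expand = solve-∀

mS≡lWitness-hS : ∀ t → mS t ≡ lWitness (hS t)
mS≡lWitness-hS t = begin
  mS t                    ≡⟨ mS≡hS*gS*gS t ⟩
  hS t * gS t * gS t      ≡⟨ *-assoc (hS t) (gS t) (gS t) ⟩
  hS t * (gS t * gS t)    ≡⟨ *-comm (hS t) _ ⟩
  gS t * gS t * hS t      ≡⟨ cong (_* hS t) (gS²≡pred-hS+hS t) ⟩
  lWitness (hS t)         ∎

module _ (t : ℕ) .{{_ : NonZero t}} where

  1<gS : 1 < gS t
  1<gS = s≤s (≤-trans (>-nonZero⁻¹ t) (m≤m+n t t))

  t<gS : t < gS t
  t<gS = s≤s (m≤m+n t t)

  1+t<gS : suc t < gS t
  1+t<gS = s≤s (+-monoˡ-≤ t (>-nonZero⁻¹ t))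

  gS<hS : gS t < hS t
  gS<hS = s≤s (≤-trans (m≤n*m (gS t) t) (m≤n+m (t * gS t) t))

  1<hS : 1 < hS t
  1<hS = <-trans 1<gS gS<hS

  gS<mS : gS t < mS t
  gS<mS = subst (gS t <_) (sym (trans (mS≡hS*gS*gS t) (*-comm (hS t * gS t) (gS t))))
    (m<m*n (gS t) (hS t * gS t) (≤-trans 1<hS (m≤m*n (hS t) (gS t))))

  hS<mS : hS t < mS t
  hS<mS = subst (hS t <_) (sym (trans (mS≡hS*gS*gS t) (*-assoc (hS t) (gS t) (gS t))))
    (m<m*n (hS t) (gS t * gS t) (≤-trans 1<gS (m≤m*n (gS t) (gS t))))

  s-gS-mS : s (gS t) (mS t) ≡ gS t
  s-gS-mS = begin
    s g (mS t)          ≡⟨ cong (s g) (mS≡hS*gS*gS t) ⟩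
    s g (hS t * g * g)  ≡⟨ s-*-base 1<gS (hS t * g) ⟩
    s g (hS t * g)      ≡⟨ s-*-base 1<gS (hS t) ⟩
    s g (suc t + t * g) ≡⟨ s-two-digits 1<gS 1+t<gS t<gS ⟩
    g                   ∎
    where
    g = gS t

  s-hS-mS : s (hS t) (mS t) ≡ hS t
  s-hS-mS = trans (cong (s (hS t)) (mS≡lWitness-hS t)) (s-lWitness 1<hS)

  mS∈S' : InS' (mS t)
  mS∈S' = <-trans z<s gS<mS
        , (gS t , 2) , (hS t , 1) ∷ []
        , (1<gS , gS<mS , z<s , ≤-reflexive (sym s-gS-mS))
          ∷ (1<hS , hS<mS , z<s , ≤-reflexive (sym s-hS-mS)) ∷ []
        , gS<hS ∷ [-]
        , refl

L⊆S'L : ∀ {m} → InL m → InS'L m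
L⊆S'L (1≤m , g , g∣m , sg≡g) = 1≤m , g , g∣m , ≤-reflexive (sym sg≡g)

Infinite-mono : ∀ {P Q : ℕ → Set} → (∀ {m} → P m → Q m) → Infinite P → Infinite Q
Infinite-mono P⊆Q P-inf N = map₂ (map₂ P⊆Q) (P-inf N)

Infinite-L : Infinite InL
Infinite-L N = lWitness (2 + N)
             , ≤-trans (m≤n+m N 2) (g≤lWitness (2 + N))
             , lWitness∈L {2 + N} (s≤s (s≤s z≤n))

Infinite-S' : Infinite InS'
Infinite-S' N = mS (suc N)
              , ≤-trans (n≤1+n N) (<⇒≤ (<-trans (t<gS (suc N)) (gS<mS (suc N))))
              , mS∈S' (suc N)

corollary2p6 : Infinite InS' × Infinite InS'L × Infinite InL
corollary2p6 = Infinite-S' , Infinite-mono L⊆S'L Infinite-L , Infinite-L
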